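{- Let $\lambda$, $\mu$, $v$ and $u$ be strictly positive integers and let $m>2$ be an integer. If there exists an $m$-cycle decomposition of $(\lambda+\mu)K_{v+u}-\lambda K_v$, then (a) $u(\lambda+\mu)+\mu(v-1)\equiv 0\pmod{2}$; (b) $v(\lambda+\mu)+(\lambda+\mu)(u-1)\equiv 0\pmod{2}$; (c) $(\lambda+\mu)\binom{u}{2}+vu(\lambda+\mu)+\mu\binom{v}{2}\equiv 0\pmod{m}$; (d) if $u<m$ then $$\left\lfloor \frac{(\lambda+\mu)\binom{u}{2}}{u-1}\right\rfloor (m-u+1)+\varepsilon_1\left(m-\frac{u-1}{2}\right)\leq \mu\binom{v}{2}+vu(\lambda+\mu),$$ where $\varepsilon_1=0$ if $u(\lambda+\mu)\equiv 0\pmod 2$ and $\varepsilon_1=1$ if $u(\lambda+\mu)\equiv 1\pmod 2$; (e) if $v<m$ then $$\left\lfloor \frac{\mu\binom{v}{2}}{v-1}\right\rfloor (m-v+1)+\varepsilon_2\left(m-\frac{v-1}{2}\right)\leq (\lambda+\mu)\binom{u}{2}+vu(\lambda+\mu),$$ where $\varepsilon_2=0$ if $\mu v\equiv 0\pmod 2$ and $\varepsilon_2=1$ if $\mu v\equiv 1\pmod 2$.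
   Context: All multigraphs are loopless. $\lambda K_n$ denotes the complete multigraph on $n$ vertices with exactly $\lambda$ parallel edges between each pair of distinct vertices. If $G_2$ is a subgraph of $G_1$, then $G_1-G_2$ is $G_1$ with the edges of $G_2$ removed; thus $(\lambda+\mu)K_{v+u}-\lambda K_v$ is the multigraph on vertex set $V\cup U$ ($|V|=v$, $|U|=u$, disjoint) obtained from $(\lambda+\mu)K_{v+u}$ by deleting the edges of a copy of $\lambda K_v$ on $V$ (so pairs inside $V$ have multiplicity $\mu$, all other pairs multiplicity $\lambda+\mu$). An $m$-cycle decomposition of a multigraph $G$ is a partition of its edge set into (edge sets of) cycles of length $m$. -}

module Defs where

open import Data.Nat using (ℕ; zero; suc; _+_; _*_; _∸_; _<_; _≤_; _≤ᵇ_)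
open import Data.Nat.DivMod using (_/_; _%_; m%n<n)
open import Data.Fin using (Fin; toℕ; fromℕ<; _≟_)
open import Data.List using (List; []; _∷_; allFin; map)
open import Data.Nat.ListAction using (sum)
open import Data.Bool using (Bool; true; false; if_then_else_; _∧_; _∨_)
open import Relation.Nullary.Decidable using (does)
open import Relation.Binary.PropositionalEquality using (_≡_; _≢_)

csuc : ∀ {m} → Fin m → Fin m
csuc {suc m} k = fromℕ< (m%n<n (suc (toℕ k)) (suc m))

-- An m-cycle in a multigraph on vertex set Fin n: a closed walk
-- c 0, c 1, …, c (m-1), c 0 through m pairwise distinct vertices.
record Cycle (n m : ℕ) : Set where
  field
    vert     : Fin m → Fin n
    distinct : ∀ a b → vert a ≡ vert b → a ≡ b
open Cycle public

edgeAt? : ∀ {n m} → Cycle n m → Fin m → Fin n → Fin n → Bool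
edgeAt? c k i j =
  (does (vert c k ≟ i) ∧ does (vert c (csuc k) ≟ j)) ∨
  (does (vert c k ≟ j) ∧ does (vert c (csuc k) ≟ i))

edgeCount : ∀ {n m} → Cycle n m → Fin n → Fin n → ℕ
edgeCount {m = m} c i j =
  sum (map (λ k → if edgeAt? c k i j then 1 else 0) (allFin m))

totalCount : ∀ {n m} → List (Cycle n m) → Fin n → Fin n → ℕ
totalCount []       i j = 0
totalCount (c ∷ cs) i j = edgeCount c i j + totalCount cs i j

-- Vertex set Fin (v + u): V = {x | toℕ x < v}, U = the remaining u vertices.
inV : (v : ℕ) → ∀ {n} → Fin n → Bool
inV v x = suc (toℕ x) ≤ᵇ v

-- Edge multiplicity of (λ+μ)K_{v+u} − λK_v between distinct vertices i, j.
multDiff : (lam mu v u : ℕ) → Fin (v + u) → Fin (v + u) → ℕ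
multDiff lam mu v u i j =
  if inV v i ∧ inV v j then mu else lam + mu

CycleDecomposition : (m lam mu v u : ℕ) → Set
CycleDecomposition m lam mu v u =
  Data.Product.Σ (List (Cycle (v + u) m)) λ cs →
    ∀ i j → i ≢ j → totalCount cs i j ≡ multDiff lam mu v u i j
  where import Data.Product

-- Floor division with the convention a ⌊/⌋ 0 = 0 (only used when the
-- numerator is 0, namely (λ+μ)·C(1,2) = 0 for u = 1, resp. μ·C(1,2) for v = 1).
_⌊/⌋_ : ℕ → ℕ → ℕ
a ⌊/⌋ zero  = 0
a ⌊/⌋ suc b = a / suc b

parity : ℕ → ℕ
parity x = x % 2

-- Everything is double counting.  For one m-cycle c and any weight w on
-- ordered pairs of vertices, the handshake lemma says
--   Σ_{i,j} w i j · edgeCount c i j  =  Σ_k ( w(c_k, c_{k+1}) + w(c_{k+1}, c_k) ).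
-- Summed over the t cycles of a decomposition, the left side becomes a sum over
-- the multigraph, whose multiplicity only depends on whether the ends lie in
-- V or U.  Choosing the weight gives the five conditions:
--   (a), (b)  weight [i = x]:    the degree of every vertex x is even;
--   (c)       weight 1:          the multigraph has t·m edges;
--   (d), (e)  weight [i,j ∈ S]:  S = U (resp. V) spans E = K·C(|S|,2) edges,
--             where K = λ+μ (resp. μ).  A cycle through m distinct vertices
--             has at most |S| − 1 edges inside S when |S| < m, so
--             E ≤ t(|S| − 1); with O + E = t·m this yields the bound.

module Submission where

open import Defs
open import Data.Nat using (ℕ; zero; suc; _+_; _*_; _∸_; _<_; _≤_; z≤n; s≤s; NonZero)
open import Data.Nat.Properties
open import Data.Nat.DivMod using (_/_; _%_; m%n<n; m<n⇒m%n≡m; n%n≡0; m≡m%n+[m/n]*n; m*n%n≡0; m*n/n≡m; m<n⇒m/n≡0; +-distrib-/)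
open import Data.Nat.Combinatorics using (_C_; nC1≡n; nCk+nC[k+1]≡[n+1]C[k+1])
open import Data.Nat.Tactic.RingSolver using (solve-∀)
open import Data.Nat.Divisibility using (_∣_; divides; ∣m∣n⇒∣m+n; m∣m*n)
import Data.Nat.ListAction as List
open import Data.Fin as Fin using (Fin; zero; suc; toℕ; fromℕ<; fromℕ; inject₁; _↑ˡ_; _↑ʳ_)
open import Data.Fin.Properties
  using (any?; toℕ-fromℕ<; toℕ-injective; toℕ-inject₁; toℕ<n; fromℕ<-toℕ; toℕ-fromℕ)
  renaming (suc-injective to Fin-suc-injective)
open import Data.List using (List; []; _∷_; length; allFin; map; tabulate)
open import Data.List.Properties using (map-tabulate)
open import Data.Bool using (Bool; true; false; if_then_else_; _∧_; _∨_; not)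
import Data.Bool.Properties as Bool
open import Data.Product using (_×_; _,_; ∃; proj₁; proj₂)
open import Data.Sum using (_⊎_; inj₁; inj₂)
open import Relation.Nullary.Decidable using (does; yes; no; _×-dec_)
open import Relation.Nullary.Negation using (¬_; contradiction)
open import Relation.Binary.PropositionalEquality
open import Function using (_∘_)
open import Algebra.Properties.Semiring.Sum +-*-semiring
  using (sum; sum-syntax; sum-cong-≗; ∑-distrib-+; ∑-comm; *-distribˡ-sum; sum-init-last)

⟦_⟧ : Bool → ℕ
⟦ b ⟧ = if b then 1 else 0

δ : ∀ {n} → Fin n → Fin n → ℕ
δ a b = ⟦ does (a Fin.≟ b) ⟧

sum-allFin : ∀ n (f : Fin n → ℕ) → List.sum (map f (allFin n)) ≡ sum f
sum-allFin n f = trans (cong List.sum (map-tabulate (λ x → x) f)) (sum-tabulate n f)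
  where
  sum-tabulate : ∀ n (f : Fin n → ℕ) → List.sum (tabulate f) ≡ sum f
  sum-tabulate zero    f = refl
  sum-tabulate (suc n) f = cong (f zero +_) (sum-tabulate n (f ∘ suc))

∑-const : ∀ n c → ∑[ i < n ] c ≡ n * c
∑-const zero    c = refl
∑-const (suc n) c = cong (c +_) (∑-const n c)

∑-zero : ∀ n {f : Fin n → ℕ} → (∀ x → f x ≡ 0) → sum f ≡ 0
∑-zero n f≡0 = trans (sum-cong-≗ f≡0) (trans (∑-const n 0) (*-zeroʳ n))

∑-mono : ∀ n {f g : Fin n → ℕ} → (∀ x → f x ≤ g x) → sum f ≤ sum g
∑-mono zero    f≤g = z≤n
∑-mono (suc n) f≤g = +-mono-≤ (f≤g zero) (∑-mono n (f≤g ∘ suc))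

∑-δ : ∀ n (a : Fin n) (f : Fin n → ℕ) → ∑[ x < n ] (δ a x * f x) ≡ f a
∑-δ (suc n) zero    f = begin
  f zero + 0 + ∑[ x < n ] (0 * f (suc x)) ≡⟨ cong (f zero + 0 +_) (∑-zero n (λ _ → refl)) ⟩
  f zero + 0 + 0                          ≡⟨ +-identityʳ _ ⟩
  f zero + 0                              ≡⟨ +-identityʳ _ ⟩
  f zero                                  ∎
  where open ≡-Reasoning
∑-δ (suc n) (suc a) f = ∑-δ n a (f ∘ suc)

⟨_,_⟩ : ∀ {n} → (Fin n → Fin n → ℕ) → (Fin n → Fin n → ℕ) → ℕ
⟨_,_⟩ {n} w N = ∑[ i < n ] ∑[ j < n ] (w i j * N i j)

⟨⟩-+ : ∀ {n} (w N N′ : Fin n → Fin n → ℕ) → ⟨ w , (λ i j → N i j + N′ i j) ⟩ ≡ ⟨ w , N ⟩ + ⟨ w , N′ ⟩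
⟨⟩-+ {n} w N N′ = begin
  ∑[ i < n ] ∑[ j < n ] (w i j * (N i j + N′ i j))
    ≡⟨ sum-cong-≗ (λ i → sum-cong-≗ (λ j → *-distribˡ-+ (w i j) (N i j) (N′ i j))) ⟩
  ∑[ i < n ] ∑[ j < n ] (w i j * N i j + w i j * N′ i j)
    ≡⟨ sum-cong-≗ (λ i → ∑-distrib-+ (λ j → w i j * N i j) (λ j → w i j * N′ i j)) ⟩
  ∑[ i < n ] (∑[ j < n ] (w i j * N i j) + ∑[ j < n ] (w i j * N′ i j))
    ≡⟨ ∑-distrib-+ (λ i → ∑[ j < n ] (w i j * N i j)) (λ i → ∑[ j < n ] (w i j * N′ i j)) ⟩
  ⟨ w , N ⟩ + ⟨ w , N′ ⟩ ∎
  where open ≡-Reasoning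

-- Used to pass from the multigraph (no loops) to
-- the formula for its multiplicity, which is only meaningful off the diagonal.
∑-except : ∀ n (x : Fin n) {g h : Fin n → ℕ} → g x ≡ 0 → (∀ j → x ≢ j → g j ≡ h j) →
  sum g + h x ≡ sum h
∑-except (suc n) zero    {g} {h} gx≡0 g≡h = begin
  g zero + sum (g ∘ suc) + h zero ≡⟨ cong (λ a → a + sum (g ∘ suc) + h zero) gx≡0 ⟩
  sum (g ∘ suc) + h zero          ≡⟨ +-comm (sum (g ∘ suc)) (h zero) ⟩
  h zero + sum (g ∘ suc)          ≡⟨ cong (h zero +_) (sum-cong-≗ (λ j → g≡h (suc j) λ ())) ⟩
  h zero + sum (h ∘ suc)          ∎
  where open ≡-Reasoning
∑-except (suc n) (suc x) {g} {h} gx≡0 g≡h = begin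
  g zero + sum (g ∘ suc) + h (suc x)   ≡⟨ +-assoc (g zero) _ _ ⟩
  g zero + (sum (g ∘ suc) + h (suc x)) ≡⟨ cong₂ _+_ (g≡h zero λ ()) (∑-except n x gx≡0 (λ j x≢j → g≡h (suc j) (x≢j ∘ Fin-suc-injective))) ⟩
  h zero + sum (h ∘ suc)               ∎
  where open ≡-Reasoning

∑-++ : ∀ v u (f : Fin (v + u) → ℕ) → sum f ≡ ∑[ i < v ] f (i ↑ˡ u) + ∑[ i < u ] f (v ↑ʳ i)
∑-++ zero    u f = refl
∑-++ (suc v) u f = trans (cong (f zero +_) (∑-++ v u (f ∘ suc))) (sym (+-assoc (f zero) _ _))

∑-pointwise-≡ : ∀ n {f g : Fin n → ℕ} → (∀ x → f x ≤ g x) → sum f ≡ sum g → ∀ x → f x ≡ g x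
∑-pointwise-≡ (suc n) {f} {g} f≤g ∑f≡∑g = at
  where
  ∑f′≤∑g′ : sum (f ∘ suc) ≤ sum (g ∘ suc)
  ∑f′≤∑g′ = ∑-mono n (f≤g ∘ suc)
  head-≡ : f zero ≡ g zero
  head-≡ = ≤-antisym (f≤g zero) (+-cancelʳ-≤ (sum (g ∘ suc)) (g zero) (f zero)
    (subst (_≤ f zero + sum (g ∘ suc)) ∑f≡∑g (+-monoʳ-≤ (f zero) ∑f′≤∑g′)))
  tail-≡ : sum (f ∘ suc) ≡ sum (g ∘ suc)
  tail-≡ = +-cancelˡ-≡ (f zero) _ _ (trans ∑f≡∑g (cong (_+ sum (g ∘ suc)) (sym head-≡)))
  at : ∀ x → f x ≡ g x
  at zero    = head-≡
  at (suc x) = ∑-pointwise-≡ n (f≤g ∘ suc) tail-≡ x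

toℕ-csuc : ∀ {m} (k : Fin (suc m)) → toℕ (csuc k) ≡ suc (toℕ k) % suc m
toℕ-csuc {m} k = toℕ-fromℕ< (m%n<n (suc (toℕ k)) (suc m))

csuc-inject₁ : ∀ {n} (k : Fin n) → csuc (inject₁ k) ≡ suc k
csuc-inject₁ {n} k = toℕ-injective (begin
  toℕ (csuc (inject₁ k))         ≡⟨ toℕ-csuc (inject₁ k) ⟩
  suc (toℕ (inject₁ k)) % suc n  ≡⟨ cong (λ a → suc a % suc n) (toℕ-inject₁ k) ⟩
  suc (toℕ k) % suc n            ≡⟨ m<n⇒m%n≡m (s≤s (toℕ<n k)) ⟩
  suc (toℕ k)                    ∎)
  where open ≡-Reasoning

csuc-last : ∀ n → csuc (fromℕ n) ≡ zero
csuc-last n = toℕ-injective (begin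
  toℕ (csuc (fromℕ n))         ≡⟨ toℕ-csuc (fromℕ n) ⟩
  suc (toℕ (fromℕ n)) % suc n  ≡⟨ cong (λ a → suc a % suc n) (toℕ-fromℕ n) ⟩
  suc n % suc n                ≡⟨ n%n≡0 (suc n) ⟩
  0                            ∎)
  where open ≡-Reasoning

∑-rotate : ∀ m (f : Fin m → ℕ) → ∑[ k < m ] f (csuc k) ≡ sum f
∑-rotate zero    f = refl
∑-rotate (suc n) f = begin
  ∑[ k < suc n ] f (csuc k)                            ≡⟨ sum-init-last (f ∘ csuc) ⟩
  ∑[ k < n ] f (csuc (inject₁ k)) + f (csuc (fromℕ n)) ≡⟨ cong₂ _+_ (sum-cong-≗ (cong f ∘ csuc-inject₁)) (cong f (csuc-last n)) ⟩
  sum (f ∘ suc) + f zero                               ≡⟨ +-comm (sum (f ∘ suc)) (f zero) ⟩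
  sum f                                                ∎
  where open ≡-Reasoning

csuc-invariant⇒constant : ∀ {m} {A : Set} (f : Fin m → A) → (∀ k → f k ≡ f (csuc k)) →
  ∀ k k′ → f k ≡ f k′
csuc-invariant⇒constant {suc m} f inv k k′ = trans (to-zero k) (sym (to-zero k′))
  where
  go : ∀ j (j<m : j < suc m) → f (fromℕ< j<m) ≡ f zero
  go zero    _   = refl
  go (suc j) j<m = trans (cong f (sym successor)) (trans (sym (inv _)) (go j j′<m))
    where
    j′<m : j < suc m
    j′<m = <-trans (n<1+n j) j<m
    successor : csuc (fromℕ< j′<m) ≡ fromℕ< j<m
    successor = toℕ-injective (begin
      toℕ (csuc (fromℕ< j′<m))         ≡⟨ toℕ-csuc (fromℕ< j′<m) ⟩
      suc (toℕ (fromℕ< j′<m)) % suc m  ≡⟨ cong (λ a → suc a % suc m) (toℕ-fromℕ< j′<m) ⟩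
      suc j % suc m                    ≡⟨ m<n⇒m%n≡m j<m ⟩
      suc j                            ≡⟨ toℕ-fromℕ< j<m ⟨
      toℕ (fromℕ< j<m)                 ∎)
      where open ≡-Reasoning
  to-zero : ∀ k → f k ≡ f zero
  to-zero k = trans (cong f (sym (fromℕ<-toℕ k (toℕ<n k)))) (go (toℕ k) (toℕ<n k))

csuc-fixed-point-free : ∀ {m} → 2 ≤ m → (k : Fin m) → k ≢ csuc k
csuc-fixed-point-free {suc zero} (s≤s ()) k
csuc-fixed-point-free {suc (suc m)} _ k k≡csuc-k with suc (toℕ k) <? suc (suc m)
... | yes k+1<m = 1+n≢n (sym (begin
  toℕ k                         ≡⟨ cong toℕ k≡csuc-k ⟩
  toℕ (csuc k)                  ≡⟨ toℕ-csuc k ⟩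
  suc (toℕ k) % suc (suc m)     ≡⟨ m<n⇒m%n≡m k+1<m ⟩
  suc (toℕ k)                   ∎))
  where open ≡-Reasoning
... | no  k+1≮m = 1+n≢0 (suc-injective (begin
  suc (suc m)                   ≡⟨ k+1≡m ⟨
  suc (toℕ k)                   ≡⟨ cong (suc ∘ toℕ) k≡csuc-k ⟩
  suc (toℕ (csuc k))            ≡⟨ cong suc (toℕ-csuc k) ⟩
  suc (suc (toℕ k) % suc (suc m)) ≡⟨ cong (λ a → suc (a % suc (suc m))) k+1≡m ⟩
  suc (suc (suc m) % suc (suc m)) ≡⟨ cong suc (n%n≡0 (suc (suc m))) ⟩
  1                             ∎))
  where
  open ≡-Reasoning
  k+1≡m : suc (toℕ k) ≡ suc (suc m)
  k+1≡m = ≤-antisym (toℕ<n k) (≮⇒≥ k+1≮m)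

⟦∨⟧-disjoint : ∀ x y z w → x ∧ w ≡ false → ⟦ (x ∧ y) ∨ (z ∧ w) ⟧ ≡ ⟦ x ⟧ * ⟦ y ⟧ + ⟦ w ⟧ * ⟦ z ⟧
⟦∨⟧-disjoint true  _     _     true  ()
⟦∨⟧-disjoint true  true  _     false _ = refl
⟦∨⟧-disjoint true  false true  false _ = refl
⟦∨⟧-disjoint true  false false false _ = refl
⟦∨⟧-disjoint false _     true  true  _ = refl
⟦∨⟧-disjoint false _     true  false _ = refl
⟦∨⟧-disjoint false _     false true  _ = refl
⟦∨⟧-disjoint false _     false false _ = refl

distinct-exclusive : ∀ {n} {a b : Fin n} → a ≢ b → ∀ i → does (a Fin.≟ i) ∧ does (b Fin.≟ i) ≡ false
distinct-exclusive {a = a} {b} a≢b i with a Fin.≟ i | b Fin.≟ i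
... | yes a≡i | yes b≡i = contradiction (trans a≡i (sym b≡i)) a≢b
... | yes _   | no  _   = refl
... | no  _   | _       = refl

∑∑-δ : ∀ n (w : Fin n → Fin n → ℕ) a b →
  ∑[ i < n ] ∑[ j < n ] (w i j * (δ a i * δ b j)) ≡ w a b
∑∑-δ n w a b = begin
  ∑[ i < n ] ∑[ j < n ] (w i j * (δ a i * δ b j))
    ≡⟨ sum-cong-≗ (λ i → sum-cong-≗ (λ j → rearrange (w i j) (δ a i) (δ b j))) ⟩
  ∑[ i < n ] ∑[ j < n ] (δ a i * (δ b j * w i j))
    ≡⟨ sum-cong-≗ (λ i → sym (*-distribˡ-sum (δ a i) (λ j → δ b j * w i j))) ⟩
  ∑[ i < n ] (δ a i * ∑[ j < n ] (δ b j * w i j))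
    ≡⟨ sum-cong-≗ (λ i → cong (δ a i *_) (∑-δ n b (w i))) ⟩
  ∑[ i < n ] (δ a i * w i b)
    ≡⟨ ∑-δ n a (λ i → w i b) ⟩
  w a b ∎
  where
  open ≡-Reasoning
  rearrange : ∀ p q r → p * (q * r) ≡ q * (r * p)
  rearrange p q r = trans (*-comm p (q * r)) (*-assoc q r p)

module CycleCounting {n m : ℕ} (m≥2 : 2 ≤ m) (c : Cycle n m) where

  from to : Fin m → Fin n
  from k = vert c k
  to   k = vert c (csuc k)

  from≢to : ∀ k → from k ≢ to k
  from≢to k eq = csuc-fixed-point-free m≥2 k (distinct c k (csuc k) eq)

  edge-indicator : ∀ k i j → ⟦ edgeAt? c k i j ⟧ ≡
    δ (from k) i * δ (to k) j + δ (to k) i * δ (from k) j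
  edge-indicator k i j =
    ⟦∨⟧-disjoint (does (from k Fin.≟ i)) (does (to k Fin.≟ j)) (does (from k Fin.≟ j)) (does (to k Fin.≟ i))
      (distinct-exclusive (from≢to k) i)

  edgeCount-∑ : ∀ i j → edgeCount c i j ≡ ∑[ k < m ] ⟦ edgeAt? c k i j ⟧
  edgeCount-∑ i j = sum-allFin m _

  no-loop : ∀ i → edgeCount c i i ≡ 0
  no-loop i = trans (edgeCount-∑ i i) (∑-zero m loop)
    where
    loop : ∀ k → ⟦ edgeAt? c k i i ⟧ ≡ 0
    loop k rewrite distinct-exclusive (from≢to k) i = refl

  edge-weight : ∀ w k → ∑[ i < n ] ∑[ j < n ] (w i j * ⟦ edgeAt? c k i j ⟧) ≡ w (from k) (to k) + w (to k) (from k)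
  edge-weight w k = begin
    ∑[ i < n ] ∑[ j < n ] (w i j * ⟦ edgeAt? c k i j ⟧)
      ≡⟨ sum-cong-≗ (λ i → sum-cong-≗ (λ j → trans (cong (w i j *_) (edge-indicator k i j)) (*-distribˡ-+ (w i j) _ _))) ⟩
    ∑[ i < n ] ∑[ j < n ] (w i j * (δ s i * δ e j) + w i j * (δ e i * δ s j))
      ≡⟨ trans (sum-cong-≗ (λ i → ∑-distrib-+ (λ j → w i j * (δ s i * δ e j)) (λ j → w i j * (δ e i * δ s j))))
               (∑-distrib-+ (λ i → ∑[ j < n ] (w i j * (δ s i * δ e j))) (λ i → ∑[ j < n ] (w i j * (δ e i * δ s j)))) ⟩
    ∑[ i < n ] ∑[ j < n ] (w i j * (δ s i * δ e j)) + ∑[ i < n ] ∑[ j < n ] (w i j * (δ e i * δ s j))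
      ≡⟨ cong₂ _+_ (∑∑-δ n w s e) (∑∑-δ n w e s) ⟩
    w s e + w e s ∎
    where
    open ≡-Reasoning
    s e : Fin n
    s = from k
    e = to k

  handshake : ∀ w → ⟨ w , edgeCount c ⟩ ≡ ∑[ k < m ] (w (from k) (to k) + w (to k) (from k))
  handshake w = begin
    ∑[ i < n ] ∑[ j < n ] (w i j * edgeCount c i j)
      ≡⟨ sum-cong-≗ (λ i → sum-cong-≗ (λ j → trans (cong (w i j *_) (edgeCount-∑ i j)) (*-distribˡ-sum (w i j) (λ k → ⟦ edgeAt? c k i j ⟧)))) ⟩
    ∑[ i < n ] ∑[ j < n ] ∑[ k < m ] (w i j * ⟦ edgeAt? c k i j ⟧)
      ≡⟨ trans (sum-cong-≗ (λ i → ∑-comm (λ j k → w i j * ⟦ edgeAt? c k i j ⟧)))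
               (∑-comm (λ i k → ∑[ j < n ] (w i j * ⟦ edgeAt? c k i j ⟧))) ⟩
    ∑[ k < m ] ∑[ i < n ] ∑[ j < n ] (w i j * ⟦ edgeAt? c k i j ⟧)
      ≡⟨ sum-cong-≗ (edge-weight w) ⟩
    ∑[ k < m ] (w (from k) (to k) + w (to k) (from k)) ∎
    where open ≡-Reasoning

  symmetric-handshake : ∀ w → (∀ a b → w a b ≡ w b a) → ⟨ w , edgeCount c ⟩ ≡ 2 * ∑[ k < m ] w (from k) (to k)
  symmetric-handshake w w-sym = trans (handshake w) (trans (sum-cong-≗ both-directions) (sym (*-distribˡ-sum 2 (λ k → w (from k) (to k)))))
    where
    both-directions : ∀ k → w (from k) (to k) + w (to k) (from k) ≡ 2 * w (from k) (to k)
    both-directions k = cong (w (from k) (to k) +_) (trans (w-sym (to k) (from k)) (sym (+-identityʳ _)))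

  degree : ∀ x → ∑[ j < n ] edgeCount c x j ≡ 2 * ∑[ k < m ] δ x (from k)
  degree x = begin
    ∑[ j < n ] edgeCount c x j
      ≡⟨ ∑-δ n x (λ i → ∑[ j < n ] edgeCount c i j) ⟨
    ∑[ i < n ] (δ x i * ∑[ j < n ] edgeCount c i j)
      ≡⟨ sum-cong-≗ (λ i → *-distribˡ-sum (δ x i) (edgeCount c i)) ⟩
    ⟨ (λ i _ → δ x i) , edgeCount c ⟩
      ≡⟨ handshake (λ i _ → δ x i) ⟩
    ∑[ k < m ] (δ x (from k) + δ x (from (csuc k)))
      ≡⟨ ∑-distrib-+ (λ k → δ x (from k)) (λ k → δ x (from (csuc k))) ⟩
    visits + ∑[ k < m ] δ x (from (csuc k))
      ≡⟨ cong (visits +_) (trans (∑-rotate m (λ k → δ x (from k))) (sym (+-identityʳ visits))) ⟩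
    2 * visits ∎
    where
    open ≡-Reasoning
    visits = ∑[ k < m ] δ x (from k)

  visits≤1 : ∀ x → ∑[ k < m ] δ (from k) x ≤ 1
  visits≤1 x with any? (λ k → from k Fin.≟ x)
  ... | yes (k₀ , from-k₀≡x) = ≤-trans (∑-mono m only-k₀) (≤-reflexive (∑-δ m k₀ (λ _ → 1)))
    where
    only-k₀ : ∀ k → δ (from k) x ≤ δ k₀ k * 1
    only-k₀ k with from k Fin.≟ x | k₀ Fin.≟ k
    ... | yes _         | yes _   = ≤-refl
    ... | yes from-k≡x | no k₀≢k = contradiction (distinct c k₀ k (trans from-k₀≡x (sym from-k≡x))) k₀≢k
    ... | no  _         | _       = z≤n
  ... | no  never = ≤-trans (≤-reflexive (∑-zero m not-visited)) z≤n
    where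
    not-visited : ∀ k → δ (from k) x ≡ 0
    not-visited k with from k Fin.≟ x
    ... | yes from-k≡x = contradiction (k , from-k≡x) never
    ... | no  _         = refl

  visits-in : (P : Fin n → Bool) → ∑[ k < m ] ⟦ P (from k) ⟧ ≤ ∑[ x < n ] ⟦ P x ⟧
  visits-in P = begin
    ∑[ k < m ] ⟦ P (from k) ⟧
      ≡⟨ sum-cong-≗ (λ k → ∑-δ n (from k) (λ x → ⟦ P x ⟧)) ⟨
    ∑[ k < m ] ∑[ x < n ] (δ (from k) x * ⟦ P x ⟧)
      ≡⟨ ∑-comm (λ k x → δ (from k) x * ⟦ P x ⟧) ⟩
    ∑[ x < n ] ∑[ k < m ] (δ (from k) x * ⟦ P x ⟧)
      ≡⟨ sum-cong-≗ (λ x → trans (sum-cong-≗ (λ k → *-comm (δ (from k) x) ⟦ P x ⟧))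
                                 (sym (*-distribˡ-sum ⟦ P x ⟧ (λ k → δ (from k) x)))) ⟩
    ∑[ x < n ] (⟦ P x ⟧ * ∑[ k < m ] δ (from k) x)
      ≤⟨ ∑-mono n (λ x → *-monoʳ-≤ ⟦ P x ⟧ (visits≤1 x)) ⟩
    ∑[ x < n ] (⟦ P x ⟧ * 1)
      ≡⟨ sum-cong-≗ (λ x → *-identityʳ ⟦ P x ⟧) ⟩
    ∑[ x < n ] ⟦ P x ⟧ ∎
    where open ≤-Reasoning

  -- If c leaves P along its k₀-th edge, that visit to P starts no inner edge,
  -- so c has at most |P| − 1 edges with both ends in P.
  inner-edges-with-exit : (P : Fin n → Bool) (k₀ : Fin m) → P (from k₀) ≡ true → P (to k₀) ≡ false →
    ∑[ k < m ] (⟦ P (from k) ⟧ * ⟦ P (to k) ⟧) ≤ ∑[ x < n ] ⟦ P x ⟧ ∸ 1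
  inner-edges-with-exit P k₀ from-in to-out = m+n≤o⇒m≤o∸n inner (≤-trans inner+1≤visits (visits-in P))
    where
    inner : ℕ
    inner = ∑[ k < m ] (⟦ P (from k) ⟧ * ⟦ P (to k) ⟧)
    inner-or-exit : ∀ k → ⟦ P (from k) ⟧ * ⟦ P (to k) ⟧ + δ k₀ k * 1 ≤ ⟦ P (from k) ⟧
    inner-or-exit k with k₀ Fin.≟ k
    inner-or-exit k | yes refl rewrite from-in | to-out = ≤-refl
    inner-or-exit k | no _ with P (from k) | P (to k)
    ... | true  | true  = ≤-refl
    ... | true  | false = z≤n
    ... | false | _     = z≤n
    inner+1≤visits : inner + 1 ≤ ∑[ k < m ] ⟦ P (from k) ⟧
    inner+1≤visits = begin
      inner + 1
        ≡⟨ cong (inner +_) (∑-δ m k₀ (λ _ → 1)) ⟨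
      inner + ∑[ k < m ] (δ k₀ k * 1)
        ≡⟨ ∑-distrib-+ (λ k → ⟦ P (from k) ⟧ * ⟦ P (to k) ⟧) (λ k → δ k₀ k * 1) ⟨
      ∑[ k < m ] (⟦ P (from k) ⟧ * ⟦ P (to k) ⟧ + δ k₀ k * 1)
        ≤⟨ ∑-mono m inner-or-exit ⟩
      ∑[ k < m ] ⟦ P (from k) ⟧ ∎
      where open ≤-Reasoning

  -- If c never leaves P, then membership in P is the same at all positions of c:
  -- [P] can only increase along c, and its sum is unchanged by a rotation.
  no-exit⇒uniform : (P : Fin n → Bool) → ¬ (∃ λ k → P (from k) ≡ true × P (to k) ≡ false) →
    ∀ k k′ → ⟦ P (from k) ⟧ ≡ ⟦ P (from k′) ⟧
  no-exit⇒uniform P never-exits = csuc-invariant⇒constant inP (∑-pointwise-≡ m monotone (sym (∑-rotate m inP)))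
    where
    inP : Fin m → ℕ
    inP k = ⟦ P (from k) ⟧
    monotone : ∀ k → ⟦ P (from k) ⟧ ≤ ⟦ P (to k) ⟧
    monotone k with P (from k) in from-in | P (to k) in to-out
    ... | true  | true  = ≤-refl
    ... | true  | false = contradiction (k , from-in , to-out) never-exits
    ... | false | _     = z≤n

  -- Key combinatorial fact: if fewer than m vertices satisfy P, then at most
  -- |P| − 1 edges of c have both ends in P.  Either c leaves P somewhere, or
  -- it lies entirely inside P (impossible, as |P| < m) or entirely outside it.
  inner-edges : (P : Fin n → Bool) → ∑[ x < n ] ⟦ P x ⟧ < m →
    ∑[ k < m ] (⟦ P (from k) ⟧ * ⟦ P (to k) ⟧) ≤ ∑[ x < n ] ⟦ P x ⟧ ∸ 1
  inner-edges P |P|<m with any? (λ k → (P (from k) Bool.≟ true) ×-dec (P (to k) Bool.≟ false))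
  ... | yes (k₀ , from-in , to-out) = inner-edges-with-exit P k₀ from-in to-out
  ... | no never-exits with any? (λ k → P (from k) Bool.≟ true)
  ...   | yes (k₀ , from-k₀-in) = contradiction (≤-trans inside-P (visits-in P)) (<⇒≱ |P|<m)
    where
    inside-P : m ≤ ∑[ k < m ] ⟦ P (from k) ⟧
    inside-P = ≤-reflexive (sym (begin
      ∑[ k < m ] ⟦ P (from k) ⟧ ≡⟨ sum-cong-≗ (λ k → trans (no-exit⇒uniform P never-exits k k₀) (cong ⟦_⟧ from-k₀-in)) ⟩
      ∑[ k < m ] 1              ≡⟨ ∑-const m 1 ⟩
      m * 1                     ≡⟨ *-identityʳ m ⟩
      m                         ∎))
      where open ≡-Reasoning
  ...   | no never-in = ≤-trans (≤-reflexive (∑-zero m outside)) z≤n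
    where
    outside : ∀ k → ⟦ P (from k) ⟧ * ⟦ P (to k) ⟧ ≡ 0
    outside k with P (from k) in from-in
    ... | true  = contradiction (k , from-in) never-in
    ... | false = refl

edgeWeight : ∀ {n m} → List (Cycle n m) → (Fin n → Fin n → ℕ) → ℕ
edgeWeight          []       w = 0
edgeWeight {m = m} (c ∷ cs) w = ∑[ k < m ] w (vert c k) (vert c (csuc k)) + edgeWeight cs w

edgeWeight-one : ∀ {n m} (cs : List (Cycle n m)) → edgeWeight cs (λ _ _ → 1) ≡ length cs * m
edgeWeight-one          []       = refl
edgeWeight-one {m = m} (c ∷ cs) = cong₂ _+_ (trans (∑-const m 1) (*-identityʳ m)) (edgeWeight-one cs)

module CycleListCounting {n m : ℕ} (m≥2 : 2 ≤ m) where
  open CycleCounting {n} {m} m≥2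

  no-loops : ∀ (cs : List (Cycle n m)) i → totalCount cs i i ≡ 0
  no-loops []       i = refl
  no-loops (c ∷ cs) i = cong₂ _+_ (no-loop c i) (no-loops cs i)

  degree-even : ∀ (cs : List (Cycle n m)) x → 2 ∣ ∑[ j < n ] totalCount cs x j
  degree-even []       x = divides 0 (∑-zero n (λ _ → refl))
  degree-even (c ∷ cs) x = subst (2 ∣_) (sym (∑-distrib-+ (edgeCount c x) (totalCount cs x)))
    (∣m∣n⇒∣m+n (subst (2 ∣_) (sym (degree c x)) (m∣m*n (∑[ k < m ] δ x (from c k)))) (degree-even cs x))

  symmetric-double-count : ∀ (cs : List (Cycle n m)) w → (∀ a b → w a b ≡ w b a) →
    ⟨ w , totalCount cs ⟩ ≡ 2 * edgeWeight cs w
  symmetric-double-count []       w w-sym = ∑-zero n (λ i → ∑-zero n (λ j → *-zeroʳ (w i j)))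
  symmetric-double-count (c ∷ cs) w w-sym = begin
    ⟨ w , totalCount (c ∷ cs) ⟩
      ≡⟨ ⟨⟩-+ w (edgeCount c) (totalCount cs) ⟩
    ⟨ w , edgeCount c ⟩ + ⟨ w , totalCount cs ⟩
      ≡⟨ cong₂ _+_ (symmetric-handshake c w w-sym) (symmetric-double-count cs w w-sym) ⟩
    2 * ∑[ k < m ] w (from c k) (to c k) + 2 * edgeWeight cs w
      ≡⟨ *-distribˡ-+ 2 (∑[ k < m ] w (from c k) (to c k)) (edgeWeight cs w) ⟨
    2 * edgeWeight (c ∷ cs) w ∎
    where open ≡-Reasoning

  inner-edge-bound : ∀ (cs : List (Cycle n m)) (P : Fin n → Bool) → ∑[ x < n ] ⟦ P x ⟧ < m →
    edgeWeight cs (λ a b → ⟦ P a ⟧ * ⟦ P b ⟧) ≤ length cs * (∑[ x < n ] ⟦ P x ⟧ ∸ 1)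
  inner-edge-bound []       P |P|<m = z≤n
  inner-edge-bound (c ∷ cs) P |P|<m = +-mono-≤ (inner-edges c P |P|<m) (inner-edge-bound cs P |P|<m)

determined : ∀ {x y d r} → 2 * x + d ≡ r → 2 * y + d ≡ r → x ≡ y
determined {x} {y} {d} p q = *-cancelˡ-≡ x y 2 (+-cancelʳ-≡ d (2 * x) (2 * y) (trans p (sym q)))

choose-2 : ∀ n → 2 * (n C 2) + n ≡ n * n
choose-2 zero    = refl
choose-2 (suc n) = begin
  2 * (suc n C 2) + suc n     ≡⟨ cong (λ c → 2 * c + suc n) Pascal ⟨
  2 * (n + n C 2) + suc n     ≡⟨ regroup n (n C 2) ⟩
  (2 * (n C 2) + n) + (1 + 2 * n) ≡⟨ cong (_+ (1 + 2 * n)) (choose-2 n) ⟩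
  n * n + (1 + 2 * n)         ≡⟨ square n ⟩
  suc n * suc n               ∎
  where
  open ≡-Reasoning
  Pascal : n + n C 2 ≡ suc n C 2
  Pascal = trans (cong (_+ n C 2) (sym (nC1≡n n))) (nCk+nC[k+1]≡[n+1]C[k+1] n 1)
  regroup : ∀ n c → 2 * (n + c) + suc n ≡ (2 * c + n) + (1 + 2 * n)
  regroup = solve-∀
  square : ∀ n → n * n + (1 + 2 * n) ≡ suc n * suc n
  square = solve-∀

width : ∀ {d m} → suc d ≤ m → m ∸ suc d + 1 ≡ m ∸ d
width {d} {m} s≤m = +-cancelʳ-≡ d (m ∸ suc d + 1) (m ∸ d)
  (trans (+-assoc (m ∸ suc d) 1 d) (trans (m∸n+n≡m s≤m) (sym (m∸n+n≡m (≤-trans (n≤1+n d) s≤m)))))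

quotient : ∀ q r d .{{_ : NonZero d}} → r < d → (q * d + r) / d ≡ q
quotient q r d r<d = begin
  (q * d + r) / d     ≡⟨ +-distrib-/ (q * d) r remainders<d ⟩
  q * d / d + r / d   ≡⟨ cong₂ _+_ (m*n/n≡m q d) (m<n⇒m/n≡0 r<d) ⟩
  q + 0               ≡⟨ +-identityʳ q ⟩
  q                   ∎
  where
  open ≡-Reasoning
  remainders<d : (q * d) % d + r % d < d
  remainders<d = subst (_< d) (sym (cong₂ _+_ (m*n%n≡0 q d) (m<n⇒m%n≡m r<d))) r<d

parity-split : ∀ x → (x % 2 ≡ 0 × x ≡ x / 2 * 2) ⊎ (x % 2 ≡ 1 × x ≡ 1 + x / 2 * 2)
parity-split x with x % 2 | m%n<n x 2 | m≡m%n+[m/n]*n x 2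
... | 0 | _ | x≡ = inj₁ (refl , x≡)
... | 1 | _ | x≡ = inj₂ (refl , x≡)
... | suc (suc _) | s≤s (s≤s ()) | _

odd-halving : ∀ E q d → 2 * E ≡ (1 + q * 2) * d → E ≡ q * d + (E ∸ q * d) × d ≡ (E ∸ q * d) * 2
odd-halving E q d 2E≡ = E≡ , d≡
  where
  open ≡-Reasoning
  h : ℕ
  h = E ∸ q * d
  expand : ∀ q d → (1 + q * 2) * d ≡ 2 * (q * d) + d
  expand = solve-∀
  qd≤E : q * d ≤ E
  qd≤E = *-cancelˡ-≤ 2 (≤-trans (m≤m+n (2 * (q * d)) d) (≤-reflexive (sym (trans 2E≡ (expand q d)))))
  E≡ : E ≡ q * d + h
  E≡ = sym (m+[n∸m]≡n qd≤E)
  d≡ : d ≡ h * 2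
  d≡ = +-cancelˡ-≡ (2 * (q * d)) d (h * 2) (begin
    2 * (q * d) + d      ≡⟨ trans 2E≡ (expand q d) ⟨
    2 * E                ≡⟨ cong (2 *_) E≡ ⟩
    2 * (q * d + h)      ≡⟨ *-distribˡ-+ 2 (q * d) h ⟩
    2 * (q * d) + 2 * h  ≡⟨ cong (2 * (q * d) +_) (*-comm 2 h) ⟩
    2 * (q * d) + h * 2  ∎)

double-inner : ∀ K d → 2 * (K * (suc d C 2)) ≡ suc d * K * d
double-inner K d = begin
  2 * (K * (suc d C 2))   ≡⟨ pull-K K (suc d C 2) ⟩
  K * (2 * (suc d C 2))   ≡⟨ cong (K *_) two-choose ⟩
  K * (suc d * d)         ≡⟨ push-K K (suc d) d ⟩
  suc d * K * d           ∎
  where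
  open ≡-Reasoning
  pull-K : ∀ K c → 2 * (K * c) ≡ K * (2 * c)
  pull-K = solve-∀
  push-K : ∀ K s d → K * (s * d) ≡ s * K * d
  push-K = solve-∀
  square : ∀ d → suc d * suc d ≡ suc d * d + suc d
  square = solve-∀
  two-choose : 2 * (suc d C 2) ≡ suc d * d
  two-choose = +-cancelʳ-≡ (suc d) _ _ (trans (choose-2 (suc d)) (square d))

-- The t cycles carry E inner and O
-- outer edges, O + E = t·m, and each cycle has at most d inner edges.
-- If E = q·d, then q ≤ t and each of q cycles has m − d outer edges.
outer-bound-exact : ∀ {d m t O q} .{{_ : NonZero d}} → d ≤ m → q * d ≤ t * d → O + q * d ≡ t * m →
  q * (m ∸ d) ≤ O
outer-bound-exact {d} {m} {t} {O} {q} d≤m qd≤td O+qd≡tm = +-cancelʳ-≤ (q * d) (q * (m ∸ d)) O (begin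
  q * (m ∸ d) + q * d   ≡⟨ *-distribˡ-+ q (m ∸ d) d ⟨
  q * (m ∸ d + d)       ≡⟨ cong (q *_) (m∸n+n≡m d≤m) ⟩
  q * m                 ≤⟨ *-monoˡ-≤ m (*-cancelʳ-≤ q t d qd≤td) ⟩
  t * m                 ≡⟨ O+qd≡tm ⟨
  O + q * d             ∎)
  where open ≤-Reasoning

-- If E = q·d + r with 0 < r, then even q + 1 ≤ t, and the cycle holding the
-- remainder r has m − r further outer edges.
outer-bound-remainder : ∀ {d m t O q r} → 0 < r → r ≤ m → d ≤ m → q * d + r ≤ t * d → O + (q * d + r) ≡ t * m →
  q * (m ∸ d) + (m ∸ r) ≤ O
outer-bound-remainder {d} {m} {t} {O} {q} {r} 0<r r≤m d≤m E≤td O+E≡tm = +-cancelʳ-≤ (q * d + r) _ O (begin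
  q * (m ∸ d) + (m ∸ r) + (q * d + r)   ≡⟨ regroup q (m ∸ d) (m ∸ r) d r ⟩
  q * (m ∸ d + d) + (m ∸ r + r)         ≡⟨ cong₂ (λ a b → q * a + b) (m∸n+n≡m d≤m) (m∸n+n≡m r≤m) ⟩
  q * m + m                             ≡⟨ +-comm (q * m) m ⟩
  suc q * m                             ≤⟨ *-monoˡ-≤ m q<t ⟩
  t * m                                 ≡⟨ O+E≡tm ⟨
  O + (q * d + r)                       ∎)
  where
  open ≤-Reasoning
  regroup : ∀ q a b d r → q * a + b + (q * d + r) ≡ q * (a + d) + (b + r)
  regroup = solve-∀
  q<t : q < t
  q<t = *-cancelʳ-< d q t (<-≤-trans (m<m+n (q * d) 0<r) E≤td)

module LargePart (K d′ m t O : ℕ) where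

  d s E x q : ℕ
  d = suc d′
  s = suc d
  E = K * (s C 2)
  x = s * K
  q = x / 2

  d≤m : s < m → d ≤ m
  d≤m s<m = ≤-trans (n≤1+n d) (<⇒≤ s<m)

  bound : s < m → E ≤ t * d → O + E ≡ t * m → E / d * (m ∸ s + 1) + parity x * (m ∸ d / 2) ≤ O
  bound s<m E≤td O+E≡tm with parity-split x
  ... | inj₁ (even , x≡q2) = begin
    E / d * (m ∸ s + 1) + parity x * (m ∸ d / 2)   ≡⟨ cong₂ (λ a b → a * (m ∸ s + 1) + b * (m ∸ d / 2)) E/d≡q even ⟩
    q * (m ∸ s + 1) + 0                             ≡⟨ trans (+-identityʳ _) (cong (q *_) (width (<⇒≤ s<m))) ⟩
    q * (m ∸ d)                                     ≤⟨ outer-bound-exact {t = t} {q = q} (d≤m s<m) (subst (_≤ t * d) E≡qd E≤td)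
                                                         (subst (λ e → O + e ≡ t * m) E≡qd O+E≡tm) ⟩
    O                                               ∎
    where
    open ≤-Reasoning
    regroup : ∀ q d → q * 2 * d ≡ 2 * (q * d)
    regroup = solve-∀
    E≡qd : E ≡ q * d
    E≡qd = *-cancelˡ-≡ E (q * d) 2 (trans (double-inner K d) (trans (cong (_* d) x≡q2) (regroup q d)))
    E/d≡q : E / d ≡ q
    E/d≡q = trans (cong (_/ d) E≡qd) (m*n/n≡m q d)
  ... | inj₂ (odd , x≡q2+1) = begin
    E / d * (m ∸ s + 1) + parity x * (m ∸ d / 2)   ≡⟨ cong₂ (λ a b → a * (m ∸ s + 1) + b * (m ∸ d / 2)) E/d≡q odd ⟩
    q * (m ∸ s + 1) + 1 * (m ∸ d / 2)               ≡⟨ cong₂ _+_ (cong (q *_) (width (<⇒≤ s<m))) (trans (*-identityˡ _) (cong (m ∸_) d/2≡h)) ⟩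
    q * (m ∸ d) + (m ∸ h)                           ≤⟨ outer-bound-remainder {t = t} {q = q} 0<h (≤-trans (<⇒≤ h<d) (d≤m s<m)) (d≤m s<m)
                                                         (subst (_≤ t * d) E≡ E≤td) (subst (λ e → O + e ≡ t * m) E≡ O+E≡tm) ⟩
    O                                               ∎
    where
    open ≤-Reasoning
    halves : E ≡ q * d + (E ∸ q * d) × d ≡ (E ∸ q * d) * 2
    halves = odd-halving E q d (trans (double-inner K d) (cong (_* d) x≡q2+1))
    h : ℕ
    h = E ∸ q * d
    E≡ : E ≡ q * d + h
    E≡ = proj₁ halves
    d≡h2 : d ≡ h * 2
    d≡h2 = proj₂ halves
    0<h : 0 < h
    0<h = n≢0⇒n>0 (λ h≡0 → 1+n≢0 (trans d≡h2 (cong (_* 2) h≡0)))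
    h<d : h < d
    h<d = subst (h <_) (sym d≡h2) (subst (h <_) (*-comm 2 h)
      (subst (λ z → h < h + z) (sym (+-identityʳ h)) (m<m+n h 0<h)))
    d/2≡h : d / 2 ≡ h
    d/2≡h = trans (cong (_/ 2) d≡h2) (m*n/n≡m h 2)
    E/d≡q : E / d ≡ q
    E/d≡q = trans (cong (_/ d) E≡) (quotient q h d h<d)

-- Write E·2 = x·d with
-- x = s·K and d = s − 1: for even x = 2q we have E = q·d, for odd x = 2q + 1
-- we have d = 2h and E = q·d + h.
outer-bound : ∀ K s m t O → s < m → 1 ≤ O → K * (s C 2) ≤ t * (s ∸ 1) → O + K * (s C 2) ≡ t * m →
  (K * (s C 2)) ⌊/⌋ (s ∸ 1) * (m ∸ s + 1) + parity (s * K) * (m ∸ ((s ∸ 1) / 2)) ≤ O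
outer-bound K zero m t O _ _ _ _ = z≤n
outer-bound K (suc zero) m t O _ O≥1 _ O+0≡tm = begin
  parity (1 * K) * m   ≤⟨ *-monoˡ-≤ m (≤-pred (m%n<n (1 * K) 2)) ⟩
  1 * m                ≡⟨ *-identityˡ m ⟩
  m                    ≤⟨ m≤t*m t O≡tm ⟩
  O                    ∎
  where
  open ≤-Reasoning
  O≡tm : O ≡ t * m
  O≡tm = trans (sym (trans (cong (O +_) (*-zeroʳ K)) (+-identityʳ O))) O+0≡tm
  m≤t*m : ∀ t → O ≡ t * m → m ≤ O
  m≤t*m zero    O≡0    = contradiction (subst (1 ≤_) O≡0 O≥1) λ ()
  m≤t*m (suc t) O≡tm′ = subst (m ≤_) (sym O≡tm′) (m≤m+n m (t * m))
outer-bound K (suc (suc d′)) m t O s<m _ E≤td O+E≡tm = LargePart.bound K d′ m t O s<m E≤td O+E≡tm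

inV-↑ˡ : ∀ {v} u (i : Fin v) → inV v (i ↑ˡ u) ≡ true
inV-↑ˡ {suc v} u zero    = refl
inV-↑ˡ {suc v} u (suc i) = inV-↑ˡ u i

inV-↑ʳ : ∀ v {u} (i : Fin u) → inV v (v ↑ʳ i) ≡ false
inV-↑ʳ zero    i = refl
inV-↑ʳ (suc v) i = inV-↑ʳ v i

-- The multigraph (λ+μ)K_{v+u} − λK_v with both parts nonempty, v = v′+1 and
-- u = u′+1.  The multiplicity of a pair depends only on the parts ("classes")
-- of its ends: μ inside V and K = λ+μ otherwise.
module Multigraph (lam mu v′ u′ : ℕ) where

  v u K : ℕ
  v = suc v′
  u = suc u′
  K = lam + mu

  class : Fin (v + u) → Bool
  class = inV v

  mult : Bool → Bool → ℕ
  mult a b = if a ∧ b then mu else K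

  ∑-class : ∀ (F : Bool → ℕ) → ∑[ j < v + u ] F (class j) ≡ v * F true + u * F false
  ∑-class F = trans (∑-++ v u (F ∘ class)) (cong₂ _+_
    (trans (sum-cong-≗ (λ i → cong F (inV-↑ˡ {v} u i))) (∑-const v (F true)))
    (trans (sum-cong-≗ (λ i → cong F (inV-↑ʳ v i))) (∑-const u (F false))))

  rowTotal : (Bool → Bool → ℕ) → Bool → ℕ
  rowTotal W a = v * (W a true * mult a true) + u * (W a false * mult a false)

  classTotal : (Bool → Bool → ℕ) → ℕ
  classTotal W = v * rowTotal W true + u * rowTotal W false

  classDiagonal : (Bool → Bool → ℕ) → ℕ
  classDiagonal W = v * (W true true * mult true true) + u * (W false false * mult false false)

  module Decomposition {m : ℕ} (m≥2 : 2 ≤ m) (cs : List (Cycle (v + u) m))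
    (covers : ∀ i j → i ≢ j → totalCount cs i j ≡ multDiff lam mu v u i j) where

    open CycleListCounting {v + u} {m} m≥2

    T : Fin (v + u) → Fin (v + u) → ℕ
    T = totalCount cs

    t : ℕ
    t = length cs

    degree : ∀ x → ∑[ j < v + u ] T x j + mult (class x) (class x) ≡ v * mult (class x) true + u * mult (class x) false
    degree x = trans (∑-except (v + u) x (no-loops cs x) (covers x)) (∑-class (mult (class x)))

    weighted-count : ∀ W → ⟨ (λ i j → W (class i) (class j)) , T ⟩ + classDiagonal W ≡ classTotal W
    weighted-count W = begin
      ⟨ w , T ⟩ + classDiagonal W
        ≡⟨ cong (⟨ w , T ⟩ +_) (∑-class (λ b → W b b * mult b b)) ⟨
      ⟨ w , T ⟩ + ∑[ i < v + u ] (w i i * M i i)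
        ≡⟨ ∑-distrib-+ (λ i → ∑[ j < v + u ] (w i j * T i j)) (λ i → w i i * M i i) ⟨
      ∑[ i < v + u ] (∑[ j < v + u ] (w i j * T i j) + w i i * M i i)
        ≡⟨ sum-cong-≗ (λ i → ∑-except (v + u) i (trans (cong (w i i *_) (no-loops cs i)) (*-zeroʳ (w i i)))
                                                  (λ j i≢j → cong (w i j *_) (covers i j i≢j))) ⟩
      ∑[ i < v + u ] ∑[ j < v + u ] (w i j * M i j)
        ≡⟨ sum-cong-≗ (λ i → ∑-class (λ b → W (class i) b * mult (class i) b)) ⟩
      ∑[ i < v + u ] rowTotal W (class i)
        ≡⟨ ∑-class (rowTotal W) ⟩
      classTotal W ∎
      where
      open ≡-Reasoning
      w M : Fin (v + u) → Fin (v + u) → ℕ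
      w i j = W (class i) (class j)
      M i j = mult (class i) (class j)

    edges-by-class : ∀ W → (∀ a b → W a b ≡ W b a) →
      2 * edgeWeight cs (λ i j → W (class i) (class j)) + classDiagonal W ≡ classTotal W
    edges-by-class W W-sym = trans
      (cong (_+ classDiagonal W) (sym (symmetric-double-count cs _ (λ a b → W-sym (class a) (class b)))))
      (weighted-count W)

    even-degree-V : 2 ∣ u * K + mu * v′
    even-degree-V = subst (2 ∣_) degree-x (degree-even cs x)
      where
      x : Fin (v + u)
      x = zero
      regroup : ∀ v′ mu u K → suc v′ * mu + u * K ≡ u * K + mu * v′ + mu
      regroup = solve-∀
      degree-x : ∑[ j < v + u ] T x j ≡ u * K + mu * v′
      degree-x = +-cancelʳ-≡ mu _ _ (trans (degree x) (regroup v′ mu u K))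

    even-degree-U : 2 ∣ v * K + K * u′
    even-degree-U = subst (2 ∣_) degree-y (degree-even cs y)
      where
      y : Fin (v + u)
      y = v ↑ʳ zero
      regroup : ∀ v K u′ → v * K + suc u′ * K ≡ v * K + K * u′ + K
      regroup = solve-∀
      degree-y : ∑[ j < v + u ] T y j ≡ v * K + K * u′
      degree-y = +-cancelʳ-≡ K _ _ (trans
        (subst (λ b → ∑[ j < v + u ] T y j + mult b b ≡ v * mult b true + u * mult b false) (inV-↑ʳ v zero) (degree y))
        (regroup v K u′))

    edge-count : K * (u C 2) + v * u * K + mu * (v C 2) ≡ t * m
    edge-count = determined binomial
      (trans (cong (λ e → 2 * e + classDiagonal one) (sym (edgeWeight-one cs))) (edges-by-class one (λ _ _ → refl)))
      where
      one : Bool → Bool → ℕ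
      one _ _ = 1
      expand : ∀ K mu v u cu cv →
        2 * (K * cu + v * u * K + mu * cv) + (v * (1 * mu) + u * (1 * K)) ≡ K * (2 * cu + u) + 2 * (v * u * K) + mu * (2 * cv + v)
      expand = solve-∀
      collect : ∀ K mu v u →
        K * (u * u) + 2 * (v * u * K) + mu * (v * v) ≡ v * (v * (1 * mu) + u * (1 * K)) + u * (v * (1 * K) + u * (1 * K))
      collect = solve-∀
      binomial : 2 * (K * (u C 2) + v * u * K + mu * (v C 2)) + classDiagonal one ≡ classTotal one
      binomial = trans (expand K mu v u (u C 2) (v C 2))
        (trans (cong₂ (λ a b → K * a + 2 * (v * u * K) + mu * b) (choose-2 u) (choose-2 v)) (collect K mu v u))

    inner-bound : ∀ (inS : Bool → Bool) s → ∑[ x < v + u ] ⟦ inS (class x) ⟧ ≡ s → s < m →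
      edgeWeight cs (λ i j → ⟦ inS (class i) ⟧ * ⟦ inS (class j) ⟧) ≤ t * (s ∸ 1)
    inner-bound inS s |S|≡s s<m = subst (λ z → _ ≤ t * (z ∸ 1)) |S|≡s
      (inner-edge-bound cs (inS ∘ class) (subst (_< m) (sym |S|≡s) s<m))

    inner-edges-U : u < m → K * (u C 2) ≤ t * u′
    inner-edges-U u<m = subst (_≤ t * u′) (sym edges-in-U) (inner-bound not u |U| u<m)
      where
      bothInU : Bool → Bool → ℕ
      bothInU a b = ⟦ not a ⟧ * ⟦ not b ⟧
      |U| : ∑[ x < v + u ] ⟦ not (class x) ⟧ ≡ u
      |U| = trans (∑-class (λ b → ⟦ not b ⟧)) (cong₂ _+_ (*-zeroʳ v) (*-identityʳ u))
      expand : ∀ K v u mu cu → 2 * (K * cu) + (v * (0 * mu) + u * (1 * K)) ≡ K * (2 * cu + u)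
      expand = solve-∀
      collect : ∀ K v u mu → K * (u * u) ≡ v * (v * (0 * mu) + u * (0 * K)) + u * (v * (0 * K) + u * (1 * K))
      collect = solve-∀
      edges-in-U : K * (u C 2) ≡ edgeWeight cs (λ i j → bothInU (class i) (class j))
      edges-in-U = determined
        (trans (expand K v u mu (u C 2)) (trans (cong (K *_) (choose-2 u)) (collect K v u mu)))
        (edges-by-class bothInU (λ a b → *-comm ⟦ not a ⟧ ⟦ not b ⟧))

    inner-edges-V : v < m → mu * (v C 2) ≤ t * v′
    inner-edges-V v<m = subst (_≤ t * v′) (sym edges-in-V) (inner-bound (λ b → b) v |V| v<m)
      where
      bothInV : Bool → Bool → ℕ
      bothInV a b = ⟦ a ⟧ * ⟦ b ⟧
      |V| : ∑[ x < v + u ] ⟦ class x ⟧ ≡ v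
      |V| = trans (∑-class ⟦_⟧) (trans (cong₂ _+_ (*-identityʳ v) (*-zeroʳ u)) (+-identityʳ v))
      expand : ∀ K v u mu cv → 2 * (mu * cv) + (v * (1 * mu) + u * (0 * K)) ≡ mu * (2 * cv + v)
      expand = solve-∀
      collect : ∀ K v u mu → mu * (v * v) ≡ v * (v * (1 * mu) + u * (0 * K)) + u * (v * (0 * K) + u * (0 * K))
      collect = solve-∀
      edges-in-V : mu * (v C 2) ≡ edgeWeight cs (λ i j → bothInV (class i) (class j))
      edges-in-V = determined
        (trans (expand K v u mu (v C 2)) (trans (cong (mu *_) (choose-2 v)) (collect K v u mu)))
        (edges-by-class bothInV (λ a b → *-comm ⟦ a ⟧ ⟦ b ⟧))

theorem2p1 : (lam mu v u m : ℕ) → 1 ≤ lam → 1 ≤ mu → 1 ≤ v → 1 ≤ u → 2 < m →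
  CycleDecomposition m lam mu v u →
    (2 ∣ u * (lam + mu) + mu * (v ∸ 1))
  × (2 ∣ v * (lam + mu) + (lam + mu) * (u ∸ 1))
  × (m ∣ (lam + mu) * (u C 2) + v * u * (lam + mu) + mu * (v C 2))
  × (u < m →
      (((lam + mu) * (u C 2)) ⌊/⌋ (u ∸ 1)) * (m ∸ u + 1)
        + parity (u * (lam + mu)) * (m ∸ ((u ∸ 1) / 2))
        ≤ mu * (v C 2) + v * u * (lam + mu))
  × (v < m →
      ((mu * (v C 2)) ⌊/⌋ (v ∸ 1)) * (m ∸ v + 1)
        + parity (mu * v) * (m ∸ ((v ∸ 1) / 2))
        ≤ (lam + mu) * (u C 2) + v * u * (lam + mu))
theorem2p1 lam mu (suc v′) (suc u′) m _ 1≤mu _ _ 2<m (cs , covers) =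
  even-degree-V , even-degree-U , divides t edge-count , bound-U , bound-V
  where
  open Multigraph lam mu v′ u′
  open Decomposition (<⇒≤ 2<m) cs covers
  -- Every pair involving U carries K ≥ μ ≥ 1 edges, so both outer counts are positive.
  1≤vuK : 1 ≤ v * u * K
  1≤vuK = ≤-trans 1≤mu (≤-trans (m≤n+m mu lam) (m≤n*m K (v * u)))
  bound-U : u < m → (K * (u C 2)) ⌊/⌋ u′ * (m ∸ u + 1) + parity (u * K) * (m ∸ (u′ / 2))
                      ≤ mu * (v C 2) + v * u * K
  bound-U u<m = outer-bound K u m t (mu * (v C 2) + v * u * K) u<m (≤-trans 1≤vuK (m≤n+m (v * u * K) (mu * (v C 2))))
    (inner-edges-U u<m) (trans (swap (mu * (v C 2)) (v * u * K) (K * (u C 2))) edge-count)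
    where
    swap : ∀ a b c → a + b + c ≡ c + b + a
    swap = solve-∀
  bound-V : v < m → (mu * (v C 2)) ⌊/⌋ v′ * (m ∸ v + 1) + parity (mu * v) * (m ∸ (v′ / 2))
                      ≤ K * (u C 2) + v * u * K
  bound-V v<m = subst (λ p → (mu * (v C 2)) ⌊/⌋ v′ * (m ∸ v + 1) + parity p * (m ∸ (v′ / 2)) ≤ K * (u C 2) + v * u * K)
    (*-comm v mu)
    (outer-bound mu v m t (K * (u C 2) + v * u * K) v<m (≤-trans 1≤vuK (m≤n+m (v * u * K) (K * (u C 2))))
      (inner-edges-V v<m) edge-count)
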